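{- Let $M_1=\begin{bmatrix} A_1 & B_1\\ 0 & C_1\end{bmatrix}$ and $M_2=\begin{bmatrix} A_2 & B_2\\ 0 & C_2\end{bmatrix}$ be two $m\times n$ ACI-matrices over a field $\mathbb{F}$, where $A_1$ and $A_2$ have the same number $n_1$ of columns. Let $R$ be a nonsingular constant matrix of order $m$, and $Q$, $Q'$ permutation matrices of orders $n_1$ and $n-n_1$ respectively, such that $$\begin{bmatrix} A_2 & B_2\\ 0 & C_2\end{bmatrix}=R\begin{bmatrix} A_1 & B_1\\ 0 & C_1\end{bmatrix}\begin{bmatrix} Q & 0\\ 0 & Q'\end{bmatrix}.$$ If $A_1$ and $A_2$ both have linearly independent rows, then $A_1\sim A_2$ and $C_1\sim C_2$.
   Context: An ACI-matrix over a field $\mathbb{F}$ is a matrix with entries in $\mathbb{F}[x_1,\dots,x_k]$, each a polynomial of degree at most one, such that no indeterminate appears in two different columns; blocks may have zero rows or zero columns. The lower-left blocks $0$ consist of zeros (their numbers of rows need not be equal a priori). Rows of an ACI-matrix are regarded as vectors in $V_1\times\cdots\times V_n$, where $V_j$ is the $\mathbb{F}$-space of polynomials of degree at most one in the indeterminates of column $j$; linear independence of rows refers to this space. For an $p\times q$ ACI-matrix $N$, $N\sim N'$ means $N'=SNP$ for some nonsingular constant matrix $S$ of order $p$ and permutation matrix $P$ of order $q$. -}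

module Defs where

open import Level using (Level; _⊔_) renaming (suc to lsuc)
open import Data.Nat using (ℕ; zero; suc) renaming (_+_ to _ℕ+_)
open import Data.Fin using (Fin; zero; suc; splitAt; cast; _≟_)
open import Data.Fin.Permutation using (Permutation′; _⟨$⟩ʳ_)
open import Data.Sum using (inj₁; inj₂)
open import Data.Product using (Σ; _×_; _,_)
open import Relation.Nullary using (¬_; yes; no)
open import Relation.Binary.PropositionalEquality using (_≡_; sym)
open import Algebra.Bundles using (CommutativeRing)

record Field (c ℓ : Level) : Set (lsuc (c ⊔ ℓ)) where
  field
    commutativeRing : CommutativeRing c ℓ
  open CommutativeRing commutativeRing public
  field
    0≉1 : ¬ (0# ≈ 1#)
    inverse : ∀ x → ¬ (x ≈ 0#) → Σ Carrier (λ y → (x * y) ≈ 1#)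

module ACI {c ℓ : Level} (F : Field c ℓ) where
  open Field F using (Carrier; _≈_; _+_; _*_; 0#; 1#)

  -- A polynomial of degree at most one in x_1,…,x_k over F:
  -- coefficient 'zero' is the constant term, coefficient 'suc t' is that of x_t.
  Poly : ℕ → Set c
  Poly k = Fin (suc k) → Carrier

  _≈P_ : ∀ {k} → Poly k → Poly k → Set ℓ
  p ≈P q = ∀ t → p t ≈ q t

  0P : ∀ {k} → Poly k
  0P _ = 0#

  _·P_ : ∀ {k} → Carrier → Poly k → Poly k
  (a ·P p) t = a * p t

  sumC : ∀ {m} → (Fin m → Carrier) → Carrier
  sumC {zero} f = 0#
  sumC {suc m} f = f zero + sumC (λ i → f (suc i))

  sumP : ∀ {k m} → (Fin m → Poly k) → Poly k
  sumP f t = sumC (λ i → f i t)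

  PMat : ℕ → ℕ → ℕ → Set c
  PMat k m n = Fin m → Fin n → Poly k

  CMat : ℕ → ℕ → Set c
  CMat m n = Fin m → Fin n → Carrier

  _≈M_ : ∀ {k m n} → PMat k m n → PMat k m n → Set ℓ
  M ≈M N = ∀ i j → M i j ≈P N i j

  _≈C_ : ∀ {m n} → CMat m n → CMat m n → Set ℓ
  S ≈C T = ∀ i j → S i j ≈ T i j

  _⊛_ : ∀ {k p m n} → CMat p m → PMat k m n → PMat k p n
  (S ⊛ M) i j = sumP (λ l → S i l ·P M l j)

  _⊙_ : ∀ {k m n q} → PMat k m n → CMat n q → PMat k m q
  (M ⊙ P) i j = sumP (λ l → P l j ·P M i l)

  _⊗_ : ∀ {m n q} → CMat m n → CMat n q → CMat m q
  (S ⊗ T) i j = sumC (λ l → S i l * T l j)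

  idC : ∀ {m} → CMat m m
  idC i j with i ≟ j
  ... | yes _ = 1#
  ... | no _ = 0#

  Nonsingular : ∀ {m} → CMat m m → Set (c ⊔ ℓ)
  Nonsingular {m} S = Σ (CMat m m) (λ T → ((S ⊗ T) ≈C idC) × ((T ⊗ S) ≈C idC))

  permMatrix : ∀ {n} → Permutation′ n → CMat n n
  permMatrix σ i j with i ≟ (σ ⟨$⟩ʳ j)
  ... | yes _ = 1#
  ... | no _ = 0#

  blockDiag : ∀ {n₁ n₂} → CMat n₁ n₁ → CMat n₂ n₂ → CMat (n₁ ℕ+ n₂) (n₁ ℕ+ n₂)
  blockDiag {n₁} Q Q' i j with splitAt n₁ i | splitAt n₁ j
  ... | inj₁ i' | inj₁ j' = Q i' j'
  ... | inj₁ _  | inj₂ _  = 0#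
  ... | inj₂ _  | inj₁ _  = 0#
  ... | inj₂ i' | inj₂ j' = Q' i' j'

  block : ∀ {k r s n₁ n₂} → PMat k r n₁ → PMat k r n₂ → PMat k s n₂ →
          PMat k (r ℕ+ s) (n₁ ℕ+ n₂)
  block {r = r} {n₁ = n₁} A B C i j with splitAt r i | splitAt n₁ j
  ... | inj₁ i' | inj₁ j' = A i' j'
  ... | inj₁ i' | inj₂ j' = B i' j'
  ... | inj₂ _  | inj₁ _  = 0P
  ... | inj₂ i' | inj₂ j' = C i' j'

  blockM : ∀ {k m r s n₁ n₂} → r ℕ+ s ≡ m → PMat k r n₁ → PMat k r n₂ →
           PMat k s n₂ → PMat k m (n₁ ℕ+ n₂)
  blockM e A B C i = block A B C (cast (sym e) i)

  Appears : ∀ {k m n} → Fin k → PMat k m n → Fin n → Set ℓ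
  Appears {m = m} t M j = Σ (Fin m) (λ i → ¬ (M i j (suc t) ≈ 0#))

  IsACI : ∀ {k m n} → PMat k m n → Set ℓ
  IsACI {k} {m} {n} M = ∀ (t : Fin k) (j j' : Fin n) →
    Appears t M j → Appears t M j' → j ≡ j'

  LinIndepRows : ∀ {k m n} → PMat k m n → Set (c ⊔ ℓ)
  LinIndepRows {k} {m} {n} M = ∀ (a : Fin m → Carrier) →
    (∀ j → sumP (λ i → a i ·P M i j) ≈P 0P) → ∀ i → a i ≈ 0#

  _∼_ : ∀ {k p q} → PMat k p q → PMat k p q → Set (c ⊔ ℓ)
  _∼_ {k} {p} {q} N N' = Σ (CMat p p) (λ S → Nonsingular S ×
    Σ (Permutation′ q) (λ σ → N' ≈M ((S ⊛ N) ⊙ permMatrix σ)))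

  -- N ∼ N' for N, N' whose row counts are not a priori equal:
  -- the row counts agree and (after identifying them) N ∼ N'.
  _∼′_ : ∀ {k p p' q} → PMat k p q → PMat k p' q → Set (c ⊔ ℓ)
  _∼′_ {k} {p} {p'} {q} N N' = Σ (p ≡ p') (λ e → N ∼ (λ i → N' (cast e i)))

module Submission where

-- Proof of Lemma 4.3.  Write R = [R₁₁ R₁₂; R₂₁ R₂₂] and T = R⁻¹ = [T₁₁ T₁₂; T₂₁ T₂₂]
-- in blocks compatible with the row splits of M₁ and M₂.  Comparing the first
-- n₁ columns of M₂ = R M₁ (Q ⊕ Q') gives A₂ = R₁₁ A₁ Q and 0 = R₂₁ A₁ Q; since
-- A₁ has independent rows, R₂₁ = 0.  Then T R = I yields T₂₁ R₁₁ = 0, hence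
-- T₂₁ A₂ = T₂₁ R₁₁ A₁ Q = 0 and, A₂ having independent rows, T₂₁ = 0.  With both
-- lower-left blocks zero, the diagonal blocks are mutually inverse:
-- R₁₁ T₁₁ = I, T₁₁ R₁₁ = I, R₂₂ T₂₂ = I, T₂₂ R₂₂ = I.  A matrix with a right
-- inverse cannot have more rows than columns (Gaussian elimination), so the
-- block sizes agree, and the last n₂ columns give C₂ = R₂₂ C₁ Q'.

open import Defs
open import Level using (Level; _⊔_)
open import Data.Nat using (ℕ; zero; suc; _+_; _<_; _≤_; s≤s; _≤?_)
open import Data.Nat.Properties using (m<n⇒m<1+n; ≰⇒>; ≤-antisym; +-cancelˡ-≡)
open import Data.Fin using (Fin; zero; suc; cast; _↑ˡ_; _↑ʳ_; splitAt; punchIn; _≟_)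
open import Data.Fin.Properties using (cast-is-id; cast-involutive; splitAt-↑ˡ; splitAt-↑ʳ; punchInᵢ≢i)
open import Data.Fin.Permutation using (Permutation′; _⟨$⟩ʳ_; _⟨$⟩ˡ_; inverseʳ)
open import Data.Vec.Functional using (insertAt)
open import Data.Vec.Functional.Properties using (insertAt-lookup; insertAt-punchIn)
open import Data.Product using (_×_; _,_)
open import Data.Sum using (_⊎_; inj₁; inj₂)
open import Data.Sum.Properties using (inj₁-injective; inj₂-injective)
open import Data.Empty using (⊥-elim)
open import Relation.Nullary using (¬_; yes; no)
open import Relation.Binary.PropositionalEquality as ≡ using (_≡_; _≢_)

module Development {c ℓ : Level} (F : Field c ℓ) where
  open Field F hiding (zero) renaming (_+_ to _⊕_)
  open ACI F
  open import Algebra.Properties.Semiring.Sum semiring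
    using (sum; sum-cong-≋; sum-replicate-zero; ∑-comm; ∑-distrib-+; *-distribˡ-sum; *-distribʳ-sum; sum-remove)
  open import Algebra.Properties.Ring ring using (-‿distribˡ-*; -‿distribʳ-*)
  open import Relation.Binary.Reasoning.Setoid setoid

  -- Finite sums.  Defs' sumC unfolds exactly like the library's sum (they agree
  -- definitionally at each length), so the library's summation lemmas transfer.
  sumC≡sum : ∀ {n} (f : Fin n → Carrier) → sumC f ≡ sum f
  sumC≡sum {zero} f = ≡.refl
  sumC≡sum {suc n} f = ≡.cong (f zero ⊕_) (sumC≡sum (λ i → f (suc i)))

  sumC≈sum : ∀ {n} (f : Fin n → Carrier) → sumC f ≈ sum f
  sumC≈sum f = reflexive (sumC≡sum f)

  sum-cong : ∀ {n} {f g : Fin n → Carrier} → (∀ i → f i ≈ g i) → sumC f ≈ sumC g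
  sum-cong {f = f} {g} f≈g = trans (sumC≈sum f) (trans (sum-cong-≋ f≈g) (sym (sumC≈sum g)))

  sum-zero : ∀ {n} {f : Fin n → Carrier} → (∀ i → f i ≈ 0#) → sumC f ≈ 0#
  sum-zero {n} f≈0 = trans (sum-cong f≈0) (trans (sumC≈sum {n} (λ _ → 0#)) (sum-replicate-zero n))

  sum-+ : ∀ {n} (f g : Fin n → Carrier) → sumC (λ i → f i ⊕ g i) ≈ sumC f ⊕ sumC g
  sum-+ f g = trans (sumC≈sum (λ i → f i ⊕ g i)) (trans (∑-distrib-+ f g) (sym (+-cong (sumC≈sum f) (sumC≈sum g))))

  *-sum : ∀ {n} a (f : Fin n → Carrier) → a * sumC f ≈ sumC (λ i → a * f i)
  *-sum a f = trans (*-congˡ (sumC≈sum f)) (trans (*-distribˡ-sum a f) (sym (sumC≈sum (λ i → a * f i))))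

  sum-* : ∀ {n} a (f : Fin n → Carrier) → sumC f * a ≈ sumC (λ i → f i * a)
  sum-* a f = trans (*-congʳ (sumC≈sum f)) (trans (*-distribʳ-sum a f) (sym (sumC≈sum (λ i → f i * a))))

  sum-swap : ∀ {n p} (f : Fin n → Fin p → Carrier) →
    sumC (λ i → sumC (f i)) ≈ sumC (λ j → sumC (λ i → f i j))
  sum-swap f = begin
    sumC (λ i → sumC (f i))          ≈⟨ sum-cong (λ i → sumC≈sum (f i)) ⟩
    sumC (λ i → sum (f i))           ≈⟨ sumC≈sum (λ i → sum (f i)) ⟩
    sum (λ i → sum (f i))            ≈⟨ ∑-comm f ⟩
    sum (λ j → sum (λ i → f i j))    ≈⟨ sumC≈sum (λ j → sum (λ i → f i j)) ⟨
    sumC (λ j → sum (λ i → f i j))   ≈⟨ sum-cong (λ j → sumC≈sum (λ i → f i j)) ⟨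
    sumC (λ j → sumC (λ i → f i j))  ∎

  sum-pick : ∀ {n} (j : Fin (suc n)) (f : Fin (suc n) → Carrier) →
    sumC f ≈ f j ⊕ sumC (λ k → f (punchIn j k))
  sum-pick j f = trans (sumC≈sum f) (trans (sum-remove f) (+-congˡ (sym (sumC≈sum (λ k → f (punchIn j k))))))

  sum-single : ∀ {n} (j : Fin n) (f : Fin n → Carrier) →
    (∀ l → l ≢ j → f l ≈ 0#) → sumC f ≈ f j
  sum-single {suc n} j f others = begin
    sumC f                              ≈⟨ sum-pick j f ⟩
    f j ⊕ sumC (λ k → f (punchIn j k))  ≈⟨ +-congˡ (sum-zero (λ k → others _ (punchInᵢ≢i j k))) ⟩
    f j ⊕ 0#                            ≈⟨ +-identityʳ (f j) ⟩
    f j                                 ∎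

  sum-++ : ∀ r s (f : Fin (r + s) → Carrier) →
    sumC f ≈ sumC (λ i → f (i ↑ˡ s)) ⊕ sumC (λ i → f (r ↑ʳ i))
  sum-++ zero s f = sym (+-identityˡ _)
  sum-++ (suc r) s f = trans (+-congˡ (sum-++ r s (λ i → f (suc i)))) (sym (+-assoc _ _ _))

  sum-cast : ∀ {n m} (e : n ≡ m) (f : Fin m → Carrier) → sumC f ≈ sumC (λ i → f (cast e i))
  sum-cast ≡.refl f = sum-cong (λ i → reflexive (≡.cong f (≡.sym (cast-is-id ≡.refl i))))

  sum-assoc : ∀ {p q} (x : Fin p → Carrier) (Y : CMat p q) (z : Fin q → Carrier) →
    sumC (λ l → sumC (λ u → x u * Y u l) * z l) ≈ sumC (λ u → x u * sumC (λ l → Y u l * z l))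
  sum-assoc x Y z = begin
    sumC (λ l → sumC (λ u → x u * Y u l) * z l)  ≈⟨ sum-cong (λ l → sum-* (z l) (λ u → x u * Y u l)) ⟩
    sumC (λ l → sumC (λ u → x u * Y u l * z l))  ≈⟨ sum-swap (λ l u → x u * Y u l * z l) ⟩
    sumC (λ u → sumC (λ l → x u * Y u l * z l))  ≈⟨ sum-cong (λ u → sum-cong (λ l → *-assoc (x u) (Y u l) (z l))) ⟩
    sumC (λ u → sumC (λ l → x u * (Y u l * z l))) ≈⟨ sum-cong (λ u → *-sum (x u) (λ l → Y u l * z l)) ⟨
    sumC (λ u → x u * sumC (λ l → Y u l * z l))  ∎

  idC-diag : ∀ {n} {i j : Fin n} → i ≡ j → idC i j ≈ 1#
  idC-diag {i = i} {j} i≡j with i ≟ j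
  ... | yes _ = refl
  ... | no i≢j = ⊥-elim (i≢j i≡j)

  idC-off : ∀ {n} {i j : Fin n} → i ≢ j → idC i j ≈ 0#
  idC-off {i = i} {j} i≢j with i ≟ j
  ... | yes i≡j = ⊥-elim (i≢j i≡j)
  ... | no _ = refl

  idC-restrict : ∀ {n m} {g : Fin n → Fin m} → (∀ {i j} → g i ≡ g j → i ≡ j) →
    ∀ i j → idC (g i) (g j) ≈ idC i j
  idC-restrict {g = g} g-inj i j with i ≟ j
  ... | yes i≡j = idC-diag (≡.cong g i≡j)
  ... | no i≢j = idC-off (λ gi≡gj → i≢j (g-inj gi≡gj))

  idC-sum : ∀ {n} (j : Fin n) (x : Fin n → Carrier) → sumC (λ l → idC j l * x l) ≈ x j
  idC-sum j x = begin
    sumC (λ l → idC j l * x l) ≈⟨ sum-single j _ (λ l l≢j → trans (*-congʳ (idC-off (λ j≡l → l≢j (≡.sym j≡l)))) (zeroˡ (x l))) ⟩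
    idC j j * x j              ≈⟨ trans (*-congʳ (idC-diag {i = j} ≡.refl)) (*-identityˡ (x j)) ⟩
    x j                        ∎

  permMatrix-hit : ∀ {n} (σ : Permutation′ n) {i j} → i ≡ σ ⟨$⟩ʳ j → permMatrix σ i j ≈ 1#
  permMatrix-hit σ {i} {j} i≡σj with i ≟ (σ ⟨$⟩ʳ j)
  ... | yes _ = refl
  ... | no i≢σj = ⊥-elim (i≢σj i≡σj)

  permMatrix-miss : ∀ {n} (σ : Permutation′ n) {i j} → i ≢ σ ⟨$⟩ʳ j → permMatrix σ i j ≈ 0#
  permMatrix-miss σ {i} {j} i≢σj with i ≟ (σ ⟨$⟩ʳ j)
  ... | yes i≡σj = ⊥-elim (i≢σj i≡σj)
  ... | no _ = refl

  permMatrix-sum : ∀ {n} (σ : Permutation′ n) j (g : Fin n → Carrier) →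
    sumC (λ l → permMatrix σ l j * g l) ≈ g (σ ⟨$⟩ʳ j)
  permMatrix-sum σ j g = begin
    sumC (λ l → permMatrix σ l j * g l)           ≈⟨ sum-single (σ ⟨$⟩ʳ j) _ (λ l l≢σj → trans (*-congʳ (permMatrix-miss σ l≢σj)) (zeroˡ (g l))) ⟩
    permMatrix σ (σ ⟨$⟩ʳ j) j * g (σ ⟨$⟩ʳ j)      ≈⟨ trans (*-congʳ (permMatrix-hit σ ≡.refl)) (*-identityˡ _) ⟩
    g (σ ⟨$⟩ʳ j)                                   ∎

  ZeroC : ∀ {p q} → CMat p q → Set ℓ
  ZeroC X = ∀ i j → X i j ≈ 0#

  ZeroM : ∀ {k p q} → PMat k p q → Set ℓ
  ZeroM N = ∀ i j → N i j ≈P 0P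

  permCols : ∀ {k p q} → PMat k p q → Permutation′ q → PMat k p q
  permCols N σ i j = N i (σ ⟨$⟩ʳ j)

  ⊙-permMatrix : ∀ {k p q} (N : PMat k p q) (σ : Permutation′ q) → (N ⊙ permMatrix σ) ≈M permCols N σ
  ⊙-permMatrix N σ i j t = permMatrix-sum σ j (λ l → N i l t)

  ⊛-assoc : ∀ {k p q r n} (X : CMat p q) (Y : CMat q r) (N : PMat k r n) → ((X ⊗ Y) ⊛ N) ≈M (X ⊛ (Y ⊛ N))
  ⊛-assoc X Y N i j t = sum-assoc (X i) Y (λ l → N l j t)

  ⊛-congʳ : ∀ {k p q n} (X : CMat p q) {N N' : PMat k q n} → N ≈M N' → (X ⊛ N) ≈M (X ⊛ N')
  ⊛-congʳ X N≈N' i j t = sum-cong (λ l → *-congˡ (N≈N' l j t))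

  ⊛-zeroˡ : ∀ {k p q n} {X : CMat p q} (N : PMat k q n) → ZeroC X → ZeroM (X ⊛ N)
  ⊛-zeroˡ N X≈0 i j t = sum-zero (λ l → trans (*-congʳ (X≈0 i l)) (zeroˡ (N l j t)))

  restrict-product : ∀ {p q m r s} (X : CMat p m) (Y : CMat m q)
    (u : Fin r → Fin m) (v : Fin s → Fin m) →
    (∀ h → sumC h ≈ sumC (λ l → h (u l)) ⊕ sumC (λ l → h (v l))) →
    ∀ i j → (∀ l → X i (v l) * Y (v l) j ≈ 0#) →
    sumC (λ l → X i (u l) * Y (u l) j) ≈ (X ⊗ Y) i j
  restrict-product X Y u v split i j v-terms≈0 = begin
    sumC (λ l → X i (u l) * Y (u l) j)                                       ≈⟨ +-identityʳ _ ⟨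
    sumC (λ l → X i (u l) * Y (u l) j) ⊕ 0#                                  ≈⟨ +-congˡ (sum-zero v-terms≈0) ⟨
    sumC (λ l → X i (u l) * Y (u l) j) ⊕ sumC (λ l → X i (v l) * Y (v l) j) ≈⟨ split (λ l → X i l * Y l j) ⟨
    (X ⊗ Y) i j                                                               ∎

  independent-cancel : ∀ {k p q n} {N : PMat k q n} (X : CMat p q) →
    LinIndepRows N → ZeroM (X ⊛ N) → ZeroC X
  independent-cancel X indep XN≈0 i = indep (X i) (XN≈0 i)

  independent-permCols : ∀ {k q n} {N : PMat k q n} (σ : Permutation′ n) →
    LinIndepRows N → LinIndepRows (permCols N σ)
  independent-permCols {N = N} σ indep a aNσ≈0 = indep a aN≈0
    where
    aN≈0 : ∀ j → sumP (λ i → a i ·P N i j) ≈P 0P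
    aN≈0 j t = trans (reflexive (≡.cong (λ j' → sumC (λ i → a i * N i j' t)) (≡.sym (inverseʳ σ))))
                     (aNσ≈0 (σ ⟨$⟩ˡ j) t)

  Injective : ∀ {b a} → CMat b a → Set (c ⊔ ℓ)
  Injective {b} {a} Y = ∀ (x : Fin a → Carrier) → (∀ i → sumC (λ l → Y i l * x l) ≈ 0#) → ∀ l → x l ≈ 0#

  -- Pivot step of Gaussian elimination: with q the inverse of the pivot Y₀ⱼ,
  -- subtract multiples of row 0 to clear column j, then delete row 0 and column j.
  eliminate : ∀ {b a} → CMat (suc b) (suc a) → Fin (suc a) → Carrier → CMat b a
  eliminate Y j q i k = Y (suc i) (punchIn j k) ⊕ (- ((Y (suc i) j * q) * Y zero (punchIn j k)))

  *-neg-* : ∀ x y z → x * (- (y * z)) ≈ (- (x * y)) * z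
  *-neg-* x y z = begin
    x * (- (y * z))   ≈⟨ -‿distribʳ-* x (y * z) ⟨
    - (x * (y * z))   ≈⟨ -‿cong (*-assoc x y z) ⟨
    - ((x * y) * z)   ≈⟨ -‿distribˡ-* (x * y) z ⟩
    (- (x * y)) * z   ∎

  eliminate-term : ∀ f d g x → (f ⊕ (- (d * g))) * x ≈ f * x ⊕ (- d) * (g * x)
  eliminate-term f d g x = trans (distribʳ x f (- (d * g))) (+-congˡ (begin
    (- (d * g)) * x   ≈⟨ -‿distribˡ-* (d * g) x ⟨
    - ((d * g) * x)   ≈⟨ -‿cong (*-assoc d g x) ⟩
    - (d * (g * x))   ≈⟨ -‿distribˡ-* d (g * x) ⟩
    (- d) * (g * x)   ∎))

  -- Every solution x of the eliminated system extends (by the value forced by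
  -- row 0 at position j) to a solution of the original one.
  eliminate-injective : ∀ {b a} (Y : CMat (suc b) (suc a)) j q → Y zero j * q ≈ 1# →
    Injective Y → Injective (eliminate Y j q)
  eliminate-injective {b} {a} Y j q pivot inj x Y'x≈0 k = begin
    x k               ≡⟨ insertAt-punchIn x j v k ⟨
    x' (punchIn j k)  ≈⟨ inj x' rows (punchIn j k) ⟩
    0#                ∎
    where
    rest : Fin (suc b) → Carrier
    rest i = sumC (λ k → Y i (punchIn j k) * x k)
    v : Carrier
    v = - (q * rest zero)
    x' : Fin (suc a) → Carrier
    x' = insertAt x j v

    row : ∀ i → sumC (λ l → Y i l * x' l) ≈ Y i j * v ⊕ rest i
    row i = trans (sum-pick j (λ l → Y i l * x' l))
                  (+-cong (*-congˡ (reflexive (insertAt-lookup x j v)))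
                          (sum-cong (λ k → *-congˡ (reflexive (insertAt-punchIn x j v k)))))

    rows : ∀ i → sumC (λ l → Y i l * x' l) ≈ 0#
    rows zero = begin
      sumC (λ l → Y zero l * x' l)         ≈⟨ row zero ⟩
      Y zero j * v ⊕ rest zero             ≈⟨ +-congʳ (*-neg-* (Y zero j) q (rest zero)) ⟩
      (- (Y zero j * q)) * rest zero ⊕ rest zero ≈⟨ +-congʳ (*-congʳ (-‿cong pivot)) ⟩
      (- 1#) * rest zero ⊕ rest zero       ≈⟨ +-congʳ (trans (sym (-‿distribˡ-* 1# (rest zero))) (-‿cong (*-identityˡ (rest zero)))) ⟩
      - rest zero ⊕ rest zero              ≈⟨ -‿inverseˡ (rest zero) ⟩
      0#                                   ∎
    rows (suc i) = begin
      sumC (λ l → Y (suc i) l * x' l)      ≈⟨ row (suc i) ⟩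
      Y (suc i) j * v ⊕ rest (suc i)       ≈⟨ +-comm _ (rest (suc i)) ⟩
      rest (suc i) ⊕ Y (suc i) j * v       ≈⟨ +-congˡ (*-neg-* (Y (suc i) j) q (rest zero)) ⟩
      rest (suc i) ⊕ (- d) * rest zero     ≈⟨ +-congˡ (*-sum (- d) (λ k → Y zero (punchIn j k) * x k)) ⟩
      rest (suc i) ⊕ sumC (λ k → (- d) * (Y zero (punchIn j k) * x k))
                                           ≈⟨ sum-+ (λ k → Y (suc i) (punchIn j k) * x k) _ ⟨
      sumC (λ k → Y (suc i) (punchIn j k) * x k ⊕ (- d) * (Y zero (punchIn j k) * x k))
                                           ≈⟨ sum-cong (λ k → eliminate-term _ d _ (x k)) ⟨
      sumC (λ k → eliminate Y j q i k * x k) ≈⟨ Y'x≈0 i ⟩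
      0#                                   ∎
      where
      d : Carrier
      d = Y (suc i) j * q

  ¬¬-∀-Fin : ∀ {p n} {P : Fin n → Set p} → (∀ l → ¬ ¬ P l) → ¬ ¬ (∀ l → P l)
  ¬¬-∀-Fin {n = zero} _ ¬all = ¬all (λ ())
  ¬¬-∀-Fin {n = suc n} {P} ¬¬P ¬all =
    ¬¬P zero (λ P₀ → ¬¬-∀-Fin (λ l → ¬¬P (suc l)) (λ Pₛ → ¬all λ { zero → P₀ ; (suc l) → Pₛ l }))

  -- Induction on the number of equations: a zero first row can be
  -- dropped, otherwise eliminate with a nonzero pivot.  Equality in the field is
  -- not decidable, so the case split is made under a double negation.
  wide-not-injective : ∀ {b a} → b < a → (Y : CMat b a) → ¬ Injective Y
  wide-not-injective {zero} {suc a} _ Y inj = 0≉1 (sym (inj (λ _ → 1#) (λ ()) zero))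
  wide-not-injective {suc b} {suc a} (s≤s b<a) Y inj = ¬¬-∀-Fin nonzero-pivot zero-row
    where
    zero-row : ¬ (∀ l → Y zero l ≈ 0#)
    zero-row Y₀≈0 = wide-not-injective (m<n⇒m<1+n b<a) (λ i → Y (suc i)) inj-tail
      where
      inj-tail : Injective (λ i → Y (suc i))
      inj-tail x rows = inj x λ { zero → sum-zero (λ l → trans (*-congʳ (Y₀≈0 l)) (zeroˡ (x l)))
                                ; (suc i) → rows i }

    nonzero-pivot : ∀ j → ¬ ¬ (Y zero j ≈ 0#)
    nonzero-pivot j Y₀ⱼ≉0 with inverse (Y zero j) Y₀ⱼ≉0
    ... | q , pivot = wide-not-injective b<a (eliminate Y j q) (eliminate-injective Y j q pivot inj)

  -- If X Y = I then Y is injective, so Y (b × a) cannot be wide: a ≤ b.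
  right-inverse-dims : ∀ {a b} (X : CMat a b) (Y : CMat b a) → (X ⊗ Y) ≈C idC → a ≤ b
  right-inverse-dims {a} {b} X Y XY≈I with a ≤? b
  ... | yes a≤b = a≤b
  ... | no a≰b = ⊥-elim (wide-not-injective (≰⇒> a≰b) Y Y-injective)
    where
    Y-injective : Injective Y
    Y-injective x Yx≈0 j = begin
      x j                                          ≈⟨ idC-sum j x ⟨
      sumC (λ l → idC j l * x l)                   ≈⟨ sum-cong (λ l → *-congʳ (XY≈I j l)) ⟨
      sumC (λ l → (X ⊗ Y) j l * x l)               ≈⟨ sum-assoc (X j) Y x ⟩
      sumC (λ i → X j i * sumC (λ l → Y i l * x l)) ≈⟨ sum-zero (λ i → trans (*-congˡ (Yx≈0 i)) (zeroʳ (X j i))) ⟩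
      0#                                           ∎

  at : ∀ {k} {p q : Poly k} t → p ≡ q → p t ≈ q t
  at t p≡q = reflexive (≡.cong (λ p → p t) p≡q)

  module Split {r s m : ℕ} (e : r + s ≡ m) where
    top : Fin r → Fin m
    top i = cast e (i ↑ˡ s)

    bot : Fin s → Fin m
    bot i = cast e (r ↑ʳ i)

    uncast-top : ∀ i → cast (≡.sym e) (top i) ≡ i ↑ˡ s
    uncast-top i = cast-involutive (≡.sym e) e (i ↑ˡ s)

    uncast-bot : ∀ i → cast (≡.sym e) (bot i) ≡ r ↑ʳ i
    uncast-bot i = cast-involutive (≡.sym e) e (r ↑ʳ i)

    side : Fin m → Fin r ⊎ Fin s
    side i = splitAt r (cast (≡.sym e) i)

    side-top : ∀ i → side (top i) ≡ inj₁ i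
    side-top i = ≡.trans (≡.cong (splitAt r) (uncast-top i)) (splitAt-↑ˡ r i s)

    side-bot : ∀ i → side (bot i) ≡ inj₂ i
    side-bot i = ≡.trans (≡.cong (splitAt r) (uncast-bot i)) (splitAt-↑ʳ r s i)

    top-injective : ∀ {i j} → top i ≡ top j → i ≡ j
    top-injective {i} {j} eq = inj₁-injective (≡.trans (≡.sym (side-top i)) (≡.trans (≡.cong side eq) (side-top j)))

    bot-injective : ∀ {i j} → bot i ≡ bot j → i ≡ j
    bot-injective {i} {j} eq = inj₂-injective (≡.trans (≡.sym (side-bot i)) (≡.trans (≡.cong side eq) (side-bot j)))

    top≢bot : ∀ {i j} → top i ≢ bot j
    top≢bot {i} {j} eq with ≡.trans (≡.sym (side-top i)) (≡.trans (≡.cong side eq) (side-bot j))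
    ... | ()

    sum-top-bot : ∀ h → sumC h ≈ sumC (λ l → h (top l)) ⊕ sumC (λ l → h (bot l))
    sum-top-bot h = trans (sum-cast e h) (sum-++ r s (λ l → h (cast e l)))

    sum-bot-top : ∀ h → sumC h ≈ sumC (λ l → h (bot l)) ⊕ sumC (λ l → h (top l))
    sum-bot-top h = trans (sum-top-bot h) (+-comm _ _)

    module _ {k n₁ n₂} (A : PMat k r n₁) (B : PMat k r n₂) (C : PMat k s n₂) where
      blockM-A : ∀ i j → blockM e A B C (top i) (j ↑ˡ n₂) ≡ A i j
      blockM-A i j rewrite uncast-top i | splitAt-↑ˡ r i s | splitAt-↑ˡ n₁ j n₂ = ≡.refl
      blockM-B : ∀ i j → blockM e A B C (top i) (n₁ ↑ʳ j) ≡ B i j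
      blockM-B i j rewrite uncast-top i | splitAt-↑ˡ r i s | splitAt-↑ʳ n₁ n₂ j = ≡.refl
      blockM-0 : ∀ i j → blockM e A B C (bot i) (j ↑ˡ n₂) ≡ 0P
      blockM-0 i j rewrite uncast-bot i | splitAt-↑ʳ r s i | splitAt-↑ˡ n₁ j n₂ = ≡.refl
      blockM-C : ∀ i j → blockM e A B C (bot i) (n₁ ↑ʳ j) ≡ C i j
      blockM-C i j rewrite uncast-bot i | splitAt-↑ʳ r s i | splitAt-↑ʳ n₁ n₂ j = ≡.refl

      ⊛-blockM-left : ∀ {p} (X : CMat p m) → ∀ i j →
        (X ⊛ blockM e A B C) i (j ↑ˡ n₂) ≈P ((λ i' l → X i' (top l)) ⊛ A) i j
      ⊛-blockM-left X i j t = begin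
        sumC (λ l → X i l * blockM e A B C l (j ↑ˡ n₂) t)  ≈⟨ sum-top-bot _ ⟩
        sumC (λ l → X i (top l) * blockM e A B C (top l) (j ↑ˡ n₂) t)
          ⊕ sumC (λ l → X i (bot l) * blockM e A B C (bot l) (j ↑ˡ n₂) t)
              ≈⟨ +-cong (sum-cong (λ l → *-congˡ (at t (blockM-A l j))))
                        (sum-zero (λ l → trans (*-congˡ (at t (blockM-0 l j))) (zeroʳ _))) ⟩
        sumC (λ l → X i (top l) * A l j t) ⊕ 0#            ≈⟨ +-identityʳ _ ⟩
        sumC (λ l → X i (top l) * A l j t)                 ∎

      ⊛-blockM-right : ∀ {p} (X : CMat p m) → ∀ i j t →
        (X ⊛ blockM e A B C) i (n₁ ↑ʳ j) t
          ≈ ((λ i' l → X i' (top l)) ⊛ B) i j t ⊕ ((λ i' l → X i' (bot l)) ⊛ C) i j t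
      ⊛-blockM-right X i j t = trans (sum-top-bot _)
        (+-cong (sum-cong (λ l → *-congˡ (at t (blockM-B l j))))
                (sum-cong (λ l → *-congˡ (at t (blockM-C l j)))))

  module _ {n₁ n₂} (Q : CMat n₁ n₁) (Q' : CMat n₂ n₂) where
    blockDiag-Q : ∀ i j → blockDiag Q Q' (i ↑ˡ n₂) (j ↑ˡ n₂) ≡ Q i j
    blockDiag-Q i j rewrite splitAt-↑ˡ n₁ i n₂ | splitAt-↑ˡ n₁ j n₂ = ≡.refl
    blockDiag-0₁₂ : ∀ i j → blockDiag Q Q' (i ↑ˡ n₂) (n₁ ↑ʳ j) ≡ 0#
    blockDiag-0₁₂ i j rewrite splitAt-↑ˡ n₁ i n₂ | splitAt-↑ʳ n₁ n₂ j = ≡.refl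
    blockDiag-0₂₁ : ∀ i j → blockDiag Q Q' (n₁ ↑ʳ i) (j ↑ˡ n₂) ≡ 0#
    blockDiag-0₂₁ i j rewrite splitAt-↑ʳ n₁ n₂ i | splitAt-↑ˡ n₁ j n₂ = ≡.refl
    blockDiag-Q' : ∀ i j → blockDiag Q Q' (n₁ ↑ʳ i) (n₁ ↑ʳ j) ≡ Q' i j
    blockDiag-Q' i j rewrite splitAt-↑ʳ n₁ n₂ i | splitAt-↑ʳ n₁ n₂ j = ≡.refl

  module _ {k p n₁ n₂} (N : PMat k p (n₁ + n₂)) (σ : Permutation′ n₁) (σ' : Permutation′ n₂) where
    private
      D : CMat (n₁ + n₂) (n₁ + n₂)
      D = blockDiag (permMatrix σ) (permMatrix σ')

    ⊙-blockDiag-left : ∀ i j → (N ⊙ D) i (j ↑ˡ n₂) ≈P N i ((σ ⟨$⟩ʳ j) ↑ˡ n₂)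
    ⊙-blockDiag-left i j t = begin
      sumC (λ l → D l (j ↑ˡ n₂) * N i l t)     ≈⟨ sum-++ n₁ n₂ _ ⟩
      sumC (λ l → D (l ↑ˡ n₂) (j ↑ˡ n₂) * N i (l ↑ˡ n₂) t)
        ⊕ sumC (λ l → D (n₁ ↑ʳ l) (j ↑ˡ n₂) * N i (n₁ ↑ʳ l) t)
          ≈⟨ +-cong (sum-cong (λ l → *-congʳ (reflexive (blockDiag-Q (permMatrix σ) (permMatrix σ') l j))))
                    (sum-zero (λ l → trans (*-congʳ (reflexive (blockDiag-0₂₁ (permMatrix σ) (permMatrix σ') l j))) (zeroˡ _))) ⟩
      sumC (λ l → permMatrix σ l j * N i (l ↑ˡ n₂) t) ⊕ 0#
          ≈⟨ trans (+-identityʳ _) (permMatrix-sum σ j (λ l → N i (l ↑ˡ n₂) t)) ⟩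
      N i ((σ ⟨$⟩ʳ j) ↑ˡ n₂) t                  ∎

    ⊙-blockDiag-right : ∀ i j → (N ⊙ D) i (n₁ ↑ʳ j) ≈P N i (n₁ ↑ʳ (σ' ⟨$⟩ʳ j))
    ⊙-blockDiag-right i j t = begin
      sumC (λ l → D l (n₁ ↑ʳ j) * N i l t)     ≈⟨ sum-++ n₁ n₂ _ ⟩
      sumC (λ l → D (l ↑ˡ n₂) (n₁ ↑ʳ j) * N i (l ↑ˡ n₂) t)
        ⊕ sumC (λ l → D (n₁ ↑ʳ l) (n₁ ↑ʳ j) * N i (n₁ ↑ʳ l) t)
          ≈⟨ +-cong (sum-zero (λ l → trans (*-congʳ (reflexive (blockDiag-0₁₂ (permMatrix σ) (permMatrix σ') l j))) (zeroˡ _)))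
                    (sum-cong (λ l → *-congʳ (reflexive (blockDiag-Q' (permMatrix σ) (permMatrix σ') l j)))) ⟩
      0# ⊕ sumC (λ l → permMatrix σ' l j * N i (n₁ ↑ʳ l) t)
          ≈⟨ trans (+-identityˡ _) (permMatrix-sum σ' j (λ l → N i (n₁ ↑ʳ l) t)) ⟩
      N i (n₁ ↑ʳ (σ' ⟨$⟩ʳ j)) t                 ∎

  similar : ∀ {k p p' q} {N : PMat k p q} {N' : PMat k p' q} → p ≡ p' →
    (X : CMat p' p) (Y : CMat p p') → (X ⊗ Y) ≈C idC → (Y ⊗ X) ≈C idC →
    (σ : Permutation′ q) → N' ≈M (X ⊛ permCols N σ) → N ∼′ N'
  similar {N = N} {N'} ≡.refl X Y XY≈I YX≈I σ N'≈XNσ =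
    ≡.refl , X , (Y , XY≈I , YX≈I) , σ , λ i j t → begin
      N' (cast ≡.refl i) j t       ≡⟨ ≡.cong (λ i' → N' i' j t) (cast-is-id ≡.refl i) ⟩
      N' i j t                     ≈⟨ N'≈XNσ i j t ⟩
      (X ⊛ permCols N σ) i j t     ≈⟨ ⊙-permMatrix (X ⊛ N) σ i j t ⟨
      ((X ⊛ N) ⊙ permMatrix σ) i j t ∎

  module Argument {k m n₁ n₂ r₁ s₁ r₂ s₂ : ℕ}
    (e₁ : r₁ + s₁ ≡ m) (e₂ : r₂ + s₂ ≡ m)
    (A₁ : PMat k r₁ n₁) (B₁ : PMat k r₁ n₂) (C₁ : PMat k s₁ n₂)
    (A₂ : PMat k r₂ n₁) (B₂ : PMat k r₂ n₂) (C₂ : PMat k s₂ n₂)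
    (R T : CMat m m) (RT≈I : (R ⊗ T) ≈C idC) (TR≈I : (T ⊗ R) ≈C idC)
    (σ : Permutation′ n₁) (σ' : Permutation′ n₂)
    (M₂≈RM₁D : blockM e₂ A₂ B₂ C₂ ≈M ((R ⊛ blockM e₁ A₁ B₁ C₁) ⊙ blockDiag (permMatrix σ) (permMatrix σ')))
    (indep₁ : LinIndepRows A₁) (indep₂ : LinIndepRows A₂) where

    module S₁ = Split {r₁} {s₁} e₁
    module S₂ = Split {r₂} {s₂} e₂

    M₁ : PMat k m (n₁ + n₂)
    M₁ = blockM e₁ A₁ B₁ C₁

    D : CMat (n₁ + n₂) (n₁ + n₂)
    D = blockDiag (permMatrix σ) (permMatrix σ')

    R₁₁ : CMat r₂ r₁
    R₁₁ i l = R (S₂.top i) (S₁.top l)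
    R₂₁ : CMat s₂ r₁
    R₂₁ i l = R (S₂.bot i) (S₁.top l)
    R₂₂ : CMat s₂ s₁
    R₂₂ i l = R (S₂.bot i) (S₁.bot l)
    T₁₁ : CMat r₁ r₂
    T₁₁ i l = T (S₁.top i) (S₂.top l)
    T₂₁ : CMat s₁ r₂
    T₂₁ i l = T (S₁.bot i) (S₂.top l)
    T₂₂ : CMat s₁ s₂
    T₂₂ i l = T (S₁.bot i) (S₂.bot l)

    A₂≈R₁₁A₁ : A₂ ≈M (R₁₁ ⊛ permCols A₁ σ)
    A₂≈R₁₁A₁ i j t = begin
      A₂ i j t                                        ≈⟨ at t (S₂.blockM-A A₂ B₂ C₂ i j) ⟨
      blockM e₂ A₂ B₂ C₂ (S₂.top i) (j ↑ˡ n₂) t        ≈⟨ M₂≈RM₁D (S₂.top i) (j ↑ˡ n₂) t ⟩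
      ((R ⊛ M₁) ⊙ D) (S₂.top i) (j ↑ˡ n₂) t            ≈⟨ ⊙-blockDiag-left (R ⊛ M₁) σ σ' (S₂.top i) j t ⟩
      (R ⊛ M₁) (S₂.top i) ((σ ⟨$⟩ʳ j) ↑ˡ n₂) t          ≈⟨ S₁.⊛-blockM-left A₁ B₁ C₁ R (S₂.top i) (σ ⟨$⟩ʳ j) t ⟩
      (R₁₁ ⊛ permCols A₁ σ) i j t                      ∎

    R₂₁A₁≈0 : ZeroM (R₂₁ ⊛ permCols A₁ σ)
    R₂₁A₁≈0 i j t = begin
      (R₂₁ ⊛ permCols A₁ σ) i j t                      ≈⟨ S₁.⊛-blockM-left A₁ B₁ C₁ R (S₂.bot i) (σ ⟨$⟩ʳ j) t ⟨
      (R ⊛ M₁) (S₂.bot i) ((σ ⟨$⟩ʳ j) ↑ˡ n₂) t          ≈⟨ ⊙-blockDiag-left (R ⊛ M₁) σ σ' (S₂.bot i) j t ⟨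
      ((R ⊛ M₁) ⊙ D) (S₂.bot i) (j ↑ˡ n₂) t            ≈⟨ M₂≈RM₁D (S₂.bot i) (j ↑ˡ n₂) t ⟨
      blockM e₂ A₂ B₂ C₂ (S₂.bot i) (j ↑ˡ n₂) t        ≈⟨ at t (S₂.blockM-0 A₂ B₂ C₂ i j) ⟩
      0#                                              ∎

    C₂≈R₂₁B₁+R₂₂C₁ : ∀ i j t →
      C₂ i j t ≈ (R₂₁ ⊛ permCols B₁ σ') i j t ⊕ (R₂₂ ⊛ permCols C₁ σ') i j t
    C₂≈R₂₁B₁+R₂₂C₁ i j t = begin
      C₂ i j t                                        ≈⟨ at t (S₂.blockM-C A₂ B₂ C₂ i j) ⟨
      blockM e₂ A₂ B₂ C₂ (S₂.bot i) (n₁ ↑ʳ j) t        ≈⟨ M₂≈RM₁D (S₂.bot i) (n₁ ↑ʳ j) t ⟩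
      ((R ⊛ M₁) ⊙ D) (S₂.bot i) (n₁ ↑ʳ j) t            ≈⟨ ⊙-blockDiag-right (R ⊛ M₁) σ σ' (S₂.bot i) j t ⟩
      (R ⊛ M₁) (S₂.bot i) (n₁ ↑ʳ (σ' ⟨$⟩ʳ j)) t         ≈⟨ S₁.⊛-blockM-right A₁ B₁ C₁ R (S₂.bot i) (σ' ⟨$⟩ʳ j) t ⟩
      (R₂₁ ⊛ permCols B₁ σ') i j t ⊕ (R₂₂ ⊛ permCols C₁ σ') i j t ∎

    -- A₁ has independent rows, so R₂₁ = 0.
    R₂₁≈0 : ZeroC R₂₁
    R₂₁≈0 = independent-cancel R₂₁ (independent-permCols σ indep₁) R₂₁A₁≈0

    -- Entry (bot₁, top₁) of T R = I, using R₂₁ = 0: T₂₁ R₁₁ = 0.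
    T₂₁R₁₁≈0 : ZeroC (T₂₁ ⊗ R₁₁)
    T₂₁R₁₁≈0 i l = begin
      (T₂₁ ⊗ R₁₁) i l                 ≈⟨ restrict-product T R S₂.top S₂.bot S₂.sum-top-bot (S₁.bot i) (S₁.top l)
                                            (λ u → trans (*-congˡ (R₂₁≈0 u l)) (zeroʳ _)) ⟩
      (T ⊗ R) (S₁.bot i) (S₁.top l)   ≈⟨ TR≈I (S₁.bot i) (S₁.top l) ⟩
      idC (S₁.bot i) (S₁.top l)       ≈⟨ idC-off (λ eq → S₁.top≢bot (≡.sym eq)) ⟩
      0#                              ∎

    -- A₂ has independent rows and T₂₁ A₂ = T₂₁ R₁₁ A₁ Q = 0, so T₂₁ = 0.
    T₂₁≈0 : ZeroC T₂₁
    T₂₁≈0 = independent-cancel T₂₁ indep₂ λ i j t → begin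
      (T₂₁ ⊛ A₂) i j t                     ≈⟨ ⊛-congʳ T₂₁ A₂≈R₁₁A₁ i j t ⟩
      (T₂₁ ⊛ (R₁₁ ⊛ permCols A₁ σ)) i j t  ≈⟨ ⊛-assoc T₂₁ R₁₁ (permCols A₁ σ) i j t ⟨
      ((T₂₁ ⊗ R₁₁) ⊛ permCols A₁ σ) i j t  ≈⟨ ⊛-zeroˡ (permCols A₁ σ) T₂₁R₁₁≈0 i j t ⟩
      0#                                   ∎

    -- With both lower-left blocks zero, the diagonal blocks are mutually inverse.
    R₁₁T₁₁≈I : (R₁₁ ⊗ T₁₁) ≈C idC
    R₁₁T₁₁≈I i j = trans (restrict-product R T S₁.top S₁.bot S₁.sum-top-bot (S₂.top i) (S₂.top j)
                            (λ l → trans (*-congˡ (T₂₁≈0 l j)) (zeroʳ _)))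
                         (trans (RT≈I _ _) (idC-restrict S₂.top-injective i j))

    T₁₁R₁₁≈I : (T₁₁ ⊗ R₁₁) ≈C idC
    T₁₁R₁₁≈I i j = trans (restrict-product T R S₂.top S₂.bot S₂.sum-top-bot (S₁.top i) (S₁.top j)
                            (λ l → trans (*-congˡ (R₂₁≈0 l j)) (zeroʳ _)))
                         (trans (TR≈I _ _) (idC-restrict S₁.top-injective i j))

    R₂₂T₂₂≈I : (R₂₂ ⊗ T₂₂) ≈C idC
    R₂₂T₂₂≈I i j = trans (restrict-product R T S₁.bot S₁.top S₁.sum-bot-top (S₂.bot i) (S₂.bot j)
                            (λ l → trans (*-congʳ (R₂₁≈0 i l)) (zeroˡ _)))
                         (trans (RT≈I _ _) (idC-restrict S₂.bot-injective i j))

    T₂₂R₂₂≈I : (T₂₂ ⊗ R₂₂) ≈C idC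
    T₂₂R₂₂≈I i j = trans (restrict-product T R S₂.bot S₂.top S₂.sum-bot-top (S₁.bot i) (S₁.bot j)
                            (λ l → trans (*-congʳ (T₂₁≈0 i l)) (zeroˡ _)))
                         (trans (TR≈I _ _) (idC-restrict S₁.bot-injective i j))

    -- Mutually inverse rectangular blocks are square.
    r₁≡r₂ : r₁ ≡ r₂
    r₁≡r₂ = ≤-antisym (right-inverse-dims T₁₁ R₁₁ T₁₁R₁₁≈I) (right-inverse-dims R₁₁ T₁₁ R₁₁T₁₁≈I)

    s₁≡s₂ : s₁ ≡ s₂
    s₁≡s₂ = +-cancelˡ-≡ r₁ s₁ s₂ (≡.trans e₁ (≡.trans (≡.sym e₂) (≡.cong (_+ s₂) (≡.sym r₁≡r₂))))

    C₂≈R₂₂C₁ : C₂ ≈M (R₂₂ ⊛ permCols C₁ σ')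
    C₂≈R₂₂C₁ i j t = begin
      C₂ i j t                                                 ≈⟨ C₂≈R₂₁B₁+R₂₂C₁ i j t ⟩
      (R₂₁ ⊛ permCols B₁ σ') i j t ⊕ (R₂₂ ⊛ permCols C₁ σ') i j t ≈⟨ +-congʳ (⊛-zeroˡ (permCols B₁ σ') R₂₁≈0 i j t) ⟩
      0# ⊕ (R₂₂ ⊛ permCols C₁ σ') i j t                         ≈⟨ +-identityˡ _ ⟩
      (R₂₂ ⊛ permCols C₁ σ') i j t                              ∎

open ACI

lemma4p3 : ∀ {c ℓ : Level} (F : Field c ℓ) (k m n₁ n₂ r₁ s₁ r₂ s₂ : ℕ)
    (e₁ : r₁ + s₁ ≡ m) (e₂ : r₂ + s₂ ≡ m)
    (A₁ : PMat F k r₁ n₁) (B₁ : PMat F k r₁ n₂) (C₁ : PMat F k s₁ n₂)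
    (A₂ : PMat F k r₂ n₁) (B₂ : PMat F k r₂ n₂) (C₂ : PMat F k s₂ n₂) →
    IsACI F (blockM F e₁ A₁ B₁ C₁) →
    IsACI F (blockM F e₂ A₂ B₂ C₂) →
    (R : CMat F m m) → Nonsingular F R →
    (Q : Permutation′ n₁) (Q' : Permutation′ n₂) →
    _≈M_ F (blockM F e₂ A₂ B₂ C₂)
      (_⊙_ F (_⊛_ F R (blockM F e₁ A₁ B₁ C₁))
        (blockDiag F (permMatrix F Q) (permMatrix F Q'))) →
    LinIndepRows F A₁ → LinIndepRows F A₂ →
    _∼′_ F A₁ A₂ × _∼′_ F C₁ C₂
lemma4p3 F k m n₁ n₂ r₁ s₁ r₂ s₂ e₁ e₂ A₁ B₁ C₁ A₂ B₂ C₂ _ _ R (T , RT≈I , TR≈I) Q Q' M₂≈RM₁D indep₁ indep₂ =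
    similar r₁≡r₂ R₁₁ T₁₁ R₁₁T₁₁≈I T₁₁R₁₁≈I Q A₂≈R₁₁A₁
  , similar s₁≡s₂ R₂₂ T₂₂ R₂₂T₂₂≈I T₂₂R₂₂≈I Q' C₂≈R₂₂C₁
  where
  open Development F
  open Argument e₁ e₂ A₁ B₁ C₁ A₂ B₂ C₂ R T RT≈I TR≈I Q Q' M₂≈RM₁D indep₁ indep₂
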